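{- Reduction in the calculus LNF is confluent.
   Context: Terms up to $\alpha$-equivalence; one-step reduction is the closure of the rules under all constructors. LNF: terms $M,N::=\uparrow V\mid x(V,y.N)\mid\mathsf{C}_v(V,x.N)$; values $V,W::=x\mid\lambda x.M$ (in $y(V,z.N)$ and $x.N$ the variable before the dot is bound in the following term). Value substitution $[V/y]$: homomorphic and capture-avoiding ($[V/y]y=V$, $[V/y]z=z$ for $z\neq y$), except: $[V/y](y(W,x.P))=\mathsf{C}_v(V,y'.y'([V/y]W,x.[V/y]P))$ with $y'$ fresh if $V$ is an abstraction, and $[x'/y](y(W,x.P))=x'([x'/y]W,x.[x'/y]P)$. Derived cut: $\mathsf{C}_v(\uparrow V:z.N)=\mathsf{C}_v(V,z.N)$; $\mathsf{C}_v(x(V,y.M):z.N)=x(V,y.\mathsf{C}_v(M:z.N))$; $\mathsf{C}_v(\mathsf{C}_v(V,y.M):z.N)=\mathsf{C}_v(V,y.\mathsf{C}_v(M:z.N))$. Rules: $(B_v)$ $\mathsf{C}_v(\lambda x.M,y.y(V,z.N))\to\mathsf{C}_v(V,x.\mathsf{C}_v(M:z.N))$ if $y\notin FV(V)\cup FV(N)$; $(\sigma_v)$ $\mathsf{C}_v(V,y.N)\to[V/y]N$ if $B_v$ does not apply. -}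

module Defs where

-- The calculus LNF, with terms up to α-equivalence represented by
-- (unscoped) de Bruijn indices.

open import Data.Nat using (ℕ; zero; suc; pred; _≡ᵇ_; _<ᵇ_)
open import Data.Bool using (if_then_else_)
open import Data.Product using (Σ; _×_; _,_)
open import Relation.Nullary using (¬_)
open import Relation.Binary.Construct.Closure.ReflexiveTransitive using (Star)

mutual
  data Val : Set where
    var : ℕ → Val
    lam : Tm → Val

  data Tm : Set where
    ret : Val → Tm
    app : ℕ → Val → Tm → Tm  -- x(V, y.N) : N binds index 0
    cut : Val → Tm → Tm      -- C_v(V, x.N) : N binds index 0

ext : (ℕ → ℕ) → ℕ → ℕ
ext ρ zero    = zero
ext ρ (suc n) = suc (ρ n)

mutual
  renV : (ℕ → ℕ) → Val → Val
  renV ρ (var x) = var (ρ x)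
  renV ρ (lam M) = lam (renT (ext ρ) M)

  renT : (ℕ → ℕ) → Tm → Tm
  renT ρ (ret V)     = ret (renV ρ V)
  renT ρ (app x V N) = app (ρ x) (renV ρ V) (renT (ext ρ) N)
  renT ρ (cut V N)   = cut (renV ρ V) (renT (ext ρ) N)

shiftV : Val → Val
shiftV = renV suc

-- Head case of value substitution, [V/y](y(W,x.P)), given W' = [V/y]W
-- and P' = [V/y]P:
--   V = x'     :  x'(W', x.P')
--   V = λ..    :  C_v(V, y'.y'(W', x.P'))   with y' fresh
headSubst : Val → Val → Tm → Tm
headSubst (var x') W' P' = app x' W' P'
headSubst (lam M)  W' P' = cut (lam M) (app zero (shiftV W') (renT (ext suc) P'))

-- [V/k] on a variable n (the binder for k is removed)
substVar : ℕ → Val → ℕ → Val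
substVar k V n = if n ≡ᵇ k then V else (if n <ᵇ k then var n else var (pred n))

mutual
  substV : ℕ → Val → Val → Val
  substV k V (var n) = substVar k V n
  substV k V (lam M) = lam (substT (suc k) (shiftV V) M)

  substT : ℕ → Val → Tm → Tm
  substT k V (ret W)     = ret (substV k V W)
  substT k V (app x W P) =
    if x ≡ᵇ k then headSubst V (substV k V W) (substT (suc k) (shiftV V) P)
    else (if x <ᵇ k then app x (substV k V W) (substT (suc k) (shiftV V) P)
          else app (pred x) (substV k V W) (substT (suc k) (shiftV V) P))
  substT k V (cut W P)   = cut (substV k V W) (substT (suc k) (shiftV V) P)

_[_] : Tm → Val → Tm
N [ V ] = substT zero V N

-- Derived cut C_v(M : z.N), N binds z as index 0
dcut : Tm → Tm → Tm
dcut (ret V)     N = cut V N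
dcut (app x V M) N = app x V (dcut M (renT (ext suc) N))
dcut (cut V M)   N = cut V (dcut M (renT (ext suc) N))

-- B_v redexes: C_v(λx.M, y.y(V, z.N)) with y ∉ FV(V) ∪ FV(N).
-- The freshness condition is expressed by V and N being weakenings
-- (not mentioning the index of y).
data BRedex : Tm → Set where
  bredex : ∀ M V N →
    BRedex (cut (lam M) (app zero (shiftV V) (renT (ext suc) N)))

data _↦_ : Tm → Tm → Set where
  Bv : ∀ M V N →
    cut (lam M) (app zero (shiftV V) (renT (ext suc) N)) ↦
    cut V (dcut M (renT (ext suc) N))
  σv : ∀ V N → ¬ BRedex (cut V N) → cut V N ↦ (N [ V ])

mutual
  data _⟶V_ : Val → Val → Set where
    ξlam : ∀ {M M'} → M ⟶ M' → lam M ⟶V lam M'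

  data _⟶_ : Tm → Tm → Set where
    root  : ∀ {M N} → M ↦ N → M ⟶ N
    ξret  : ∀ {V V'} → V ⟶V V' → ret V ⟶ ret V'
    ξappV : ∀ {x V V' N} → V ⟶V V' → app x V N ⟶ app x V' N
    ξappN : ∀ {x V N N'} → N ⟶ N' → app x V N ⟶ app x V N'
    ξcutV : ∀ {V V' N} → V ⟶V V' → cut V N ⟶ cut V' N
    ξcutN : ∀ {V N N'} → N ⟶ N' → cut V N ⟶ cut V N'

_⟶*_ : Tm → Tm → Set
_⟶*_ = Star _⟶_

Confluent : Set
Confluent = ∀ {M N₁ N₂} → M ⟶* N₁ → M ⟶* N₂ →
  Σ Tm (λ P → (N₁ ⟶* P) × (N₂ ⟶* P))

module Submission where

-- Parallel reduction ⇒ contracts any set of redexes at once, with two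
-- liberalisations: σ may fire even on a B-redex, where it is the identity,
-- and B is generalised to C_v(λx.A, y.y(W, z.P)) with y possibly free in W
-- and P, its contractum substituting λx.A for y (which changes nothing when
-- y is fresh). Then ⟶ ⊆ ⇒ ⊆ ⟶*, since the generalised B factors as a σ-step
-- followed by a genuine B-step. Parallel reduction is stable under renaming,
-- substitution and the derived cut, and every M ⇒ N satisfies N ⇒ dev M for
-- the complete development dev; this triangle property makes ⇒, and hence ⟶,
-- confluent.

open import Defs
open import Data.Nat using (ℕ; zero; suc; pred; _≡ᵇ_; _<ᵇ_) renaming (_≟_ to _≟ℕ_)
open import Data.Bool using (true; false; if_then_else_)
open import Data.Product using (Σ; _×_; _,_)
open import Function using (_∘_; id)
open import Relation.Binary.PropositionalEquality hiding ([_])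
open import Relation.Nullary using (Dec; yes; no)
open import Relation.Nullary.Decidable using (map′; _×-dec_)
open import Relation.Binary.Construct.Closure.ReflexiveTransitive
  using (Star; ε; _◅_; _◅◅_; gmap; _⋆)
import Relation.Binary.Rewriting as Rewriting
open ≡-Reasoning

cong₃ : ∀ {A B C D : Set} (f : A → B → C → D) {a a' b b' c c'} →
  a ≡ a' → b ≡ b' → c ≡ c' → f a b c ≡ f a' b' c'
cong₃ f refl refl refl = refl

module _ {a ℓ} {A : Set a} {_▷_ : A → A → Set ℓ} where

  triangle⇒confluent : (f : A → A) → (∀ {x y} → x ▷ y → y ▷ f x) →
    Rewriting.Confluent _▷_
  triangle⇒confluent f triangle = confluent
    where
    strip : ∀ {x y z} → x ▷ y → Star _▷_ x z → Σ A λ w → Star _▷_ y w × z ▷ w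
    strip x▷y ε = _ , ε , x▷y
    strip x▷y (x▷u ◅ u▷*z) with strip (triangle x▷u) u▷*z
    ... | w , fx▷*w , z▷w = w , triangle x▷y ◅ fx▷*w , z▷w

    confluent : Rewriting.Confluent _▷_
    confluent ε x▷*z = _ , x▷*z , ε
    confluent (x▷y ◅ y▷*u) x▷*z with strip x▷y x▷*z
    ... | w , y▷*w , z▷w with confluent y▷*u y▷*w
    ... | v , u▷*v , w▷*v = v , u▷*v , z▷w ◅ w▷*v

confluent-between : ∀ {a ℓ₁ ℓ₂} {A : Set a}
  {_⟶₁_ : A → A → Set ℓ₁} {_⟶₂_ : A → A → Set ℓ₂} →
  (∀ {x y} → x ⟶₁ y → x ⟶₂ y) → (∀ {x y} → x ⟶₂ y → Star _⟶₁_ x y) →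
  Rewriting.Confluent _⟶₂_ → Rewriting.Confluent _⟶₁_
confluent-between ⟶₁⊆⟶₂ ⟶₂⊆⟶₁* confluent x⟶₁*y x⟶₁*z
  with confluent (gmap id ⟶₁⊆⟶₂ x⟶₁*y) (gmap id ⟶₁⊆⟶₂ x⟶₁*z)
... | w , y⟶₂*w , z⟶₂*w = w , (⟶₂⊆⟶₁* ⋆) y⟶₂*w , (⟶₂⊆⟶₁* ⋆) z⟶₂*w

ext-cong : ∀ {ρ ρ'} → ρ ≗ ρ' → ext ρ ≗ ext ρ'
ext-cong e zero    = refl
ext-cong e (suc n) = cong suc (e n)

mutual
  renV-cong : ∀ {ρ ρ'} → ρ ≗ ρ' → ∀ V → renV ρ V ≡ renV ρ' V
  renV-cong e (var x) = cong var (e x)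
  renV-cong e (lam M) = cong lam (renT-cong (ext-cong e) M)

  renT-cong : ∀ {ρ ρ'} → ρ ≗ ρ' → ∀ M → renT ρ M ≡ renT ρ' M
  renT-cong e (ret V)     = cong ret (renV-cong e V)
  renT-cong e (app x V N) = cong₃ app (e x) (renV-cong e V) (renT-cong (ext-cong e) N)
  renT-cong e (cut V N)   = cong₂ cut (renV-cong e V) (renT-cong (ext-cong e) N)

ext-∘ : ∀ ρ' ρ → ext ρ' ∘ ext ρ ≗ ext (ρ' ∘ ρ)
ext-∘ ρ' ρ zero    = refl
ext-∘ ρ' ρ (suc n) = refl

mutual
  renV-renV : ∀ ρ' ρ V → renV ρ' (renV ρ V) ≡ renV (ρ' ∘ ρ) V
  renV-renV ρ' ρ (var x) = refl
  renV-renV ρ' ρ (lam M) =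
    cong lam (trans (renT-renT (ext ρ') (ext ρ) M) (renT-cong (ext-∘ ρ' ρ) M))

  renT-renT : ∀ ρ' ρ M → renT ρ' (renT ρ M) ≡ renT (ρ' ∘ ρ) M
  renT-renT ρ' ρ (ret V)     = cong ret (renV-renV ρ' ρ V)
  renT-renT ρ' ρ (app x V N) = cong₂ (app (ρ' (ρ x))) (renV-renV ρ' ρ V)
    (trans (renT-renT (ext ρ') (ext ρ) N) (renT-cong (ext-∘ ρ' ρ) N))
  renT-renT ρ' ρ (cut V N)   = cong₂ cut (renV-renV ρ' ρ V)
    (trans (renT-renT (ext ρ') (ext ρ) N) (renT-cong (ext-∘ ρ' ρ) N))

ext-id : ∀ {ρ} → ρ ≗ id → ext ρ ≗ id
ext-id e zero    = refl
ext-id e (suc n) = cong suc (e n)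

mutual
  renV-id : ∀ {ρ} → ρ ≗ id → ∀ V → renV ρ V ≡ V
  renV-id e (var x) = cong var (e x)
  renV-id e (lam M) = cong lam (renT-id (ext-id e) M)

  renT-id : ∀ {ρ} → ρ ≗ id → ∀ M → renT ρ M ≡ M
  renT-id e (ret V)     = cong ret (renV-id e V)
  renT-id e (app x V N) = cong₃ app (e x) (renV-id e V) (renT-id (ext-id e) N)
  renT-id e (cut V N)   = cong₂ cut (renV-id e V) (renT-id (ext-id e) N)

renV-comm : ∀ {ρ₁ ρ₂ ρ₃ ρ₄} → ρ₁ ∘ ρ₂ ≗ ρ₃ ∘ ρ₄ → ∀ V →
  renV ρ₁ (renV ρ₂ V) ≡ renV ρ₃ (renV ρ₄ V)
renV-comm {ρ₁} {ρ₂} {ρ₃} {ρ₄} e V =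
  trans (renV-renV ρ₁ ρ₂ V) (trans (renV-cong e V) (sym (renV-renV ρ₃ ρ₄ V)))

renT-comm : ∀ {ρ₁ ρ₂ ρ₃ ρ₄} → ρ₁ ∘ ρ₂ ≗ ρ₃ ∘ ρ₄ → ∀ M →
  renT ρ₁ (renT ρ₂ M) ≡ renT ρ₃ (renT ρ₄ M)
renT-comm {ρ₁} {ρ₂} {ρ₃} {ρ₄} e M =
  trans (renT-renT ρ₁ ρ₂ M) (trans (renT-cong e M) (sym (renT-renT ρ₃ ρ₄ M)))

ext-suc-natural : ∀ ρ → ext (ext ρ) ∘ ext suc ≗ ext suc ∘ ext ρ
ext-suc-natural ρ zero    = refl
ext-suc-natural ρ (suc n) = refl

renV-pred-shiftV : ∀ W → renV pred (shiftV W) ≡ W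
renV-pred-shiftV W = trans (renV-renV pred suc W) (renV-id (λ _ → refl) W)

renT-ext-pred-ext-suc : ∀ P → renT (ext pred) (renT (ext suc) P) ≡ P
renT-ext-pred-ext-suc P =
  trans (renT-renT (ext pred) (ext suc) P) (renT-id (λ { zero → refl ; (suc n) → refl }) P)

-- Simultaneous substitution

Sub : Set
Sub = ℕ → Val

exts : Sub → Sub
exts σ zero    = var zero
exts σ (suc n) = shiftV (σ n)

mutual
  subV : Sub → Val → Val
  subV σ (var n) = σ n
  subV σ (lam M) = lam (subT (exts σ) M)

  subT : Sub → Tm → Tm
  subT σ (ret W)     = ret (subV σ W)
  subT σ (app x W P) = headSubst (σ x) (subV σ W) (subT (exts σ) P)
  subT σ (cut W P)   = cut (subV σ W) (subT (exts σ) P)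

exts-cong : ∀ {σ σ'} → σ ≗ σ' → exts σ ≗ exts σ'
exts-cong e zero    = refl
exts-cong e (suc n) = cong shiftV (e n)

mutual
  subV-cong : ∀ {σ σ'} → σ ≗ σ' → ∀ V → subV σ V ≡ subV σ' V
  subV-cong e (var x) = e x
  subV-cong e (lam M) = cong lam (subT-cong (exts-cong e) M)

  subT-cong : ∀ {σ σ'} → σ ≗ σ' → ∀ M → subT σ M ≡ subT σ' M
  subT-cong e (ret V)     = cong ret (subV-cong e V)
  subT-cong e (app x V N) = cong₃ headSubst (e x) (subV-cong e V) (subT-cong (exts-cong e) N)
  subT-cong e (cut V N)   = cong₂ cut (subV-cong e V) (subT-cong (exts-cong e) N)

exts-ext : ∀ σ ρ → exts σ ∘ ext ρ ≗ exts (σ ∘ ρ)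
exts-ext σ ρ zero    = refl
exts-ext σ ρ (suc n) = refl

mutual
  subV-renV : ∀ σ ρ V → subV σ (renV ρ V) ≡ subV (σ ∘ ρ) V
  subV-renV σ ρ (var x) = refl
  subV-renV σ ρ (lam M) =
    cong lam (trans (subT-renT (exts σ) (ext ρ) M) (subT-cong (exts-ext σ ρ) M))

  subT-renT : ∀ σ ρ M → subT σ (renT ρ M) ≡ subT (σ ∘ ρ) M
  subT-renT σ ρ (ret V)     = cong ret (subV-renV σ ρ V)
  subT-renT σ ρ (app x V N) = cong₂ (headSubst (σ (ρ x))) (subV-renV σ ρ V)
    (trans (subT-renT (exts σ) (ext ρ) N) (subT-cong (exts-ext σ ρ) N))
  subT-renT σ ρ (cut V N)   = cong₂ cut (subV-renV σ ρ V)
    (trans (subT-renT (exts σ) (ext ρ) N) (subT-cong (exts-ext σ ρ) N))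

renT-headSubst : ∀ ρ U W P →
  renT ρ (headSubst U W P) ≡ headSubst (renV ρ U) (renV ρ W) (renT (ext ρ) P)
renT-headSubst ρ (var y) W P = refl
renT-headSubst ρ (lam A) W P = cong (cut (lam (renT (ext ρ) A)))
  (cong₂ (app zero) (renV-comm (λ _ → refl) W) (renT-comm (ext-suc-natural ρ) P))

renV-exts : ∀ ρ σ → renV (ext ρ) ∘ exts σ ≗ exts (renV ρ ∘ σ)
renV-exts ρ σ zero    = refl
renV-exts ρ σ (suc n) = renV-comm (λ _ → refl) (σ n)

mutual
  renV-subV : ∀ ρ σ V → renV ρ (subV σ V) ≡ subV (renV ρ ∘ σ) V
  renV-subV ρ σ (var x) = refl
  renV-subV ρ σ (lam M) =
    cong lam (trans (renT-subT (ext ρ) (exts σ) M) (subT-cong (renV-exts ρ σ) M))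

  renT-subT : ∀ ρ σ M → renT ρ (subT σ M) ≡ subT (renV ρ ∘ σ) M
  renT-subT ρ σ (ret V)     = cong ret (renV-subV ρ σ V)
  renT-subT ρ σ (app x V N) = trans (renT-headSubst ρ (σ x) (subV σ V) (subT (exts σ) N))
    (cong₂ (headSubst (renV ρ (σ x))) (renV-subV ρ σ V)
      (trans (renT-subT (ext ρ) (exts σ) N) (subT-cong (renV-exts ρ σ) N)))
  renT-subT ρ σ (cut V N)   = cong₂ cut (renV-subV ρ σ V)
    (trans (renT-subT (ext ρ) (exts σ) N) (subT-cong (renV-exts ρ σ) N))

subV-exts-shiftV : ∀ σ W → subV (exts σ) (shiftV W) ≡ shiftV (subV σ W)
subV-exts-shiftV σ W = trans (subV-renV (exts σ) suc W) (sym (renV-subV suc σ W))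

subT-exts²-ext-suc : ∀ σ P →
  subT (exts (exts σ)) (renT (ext suc) P) ≡ renT (ext suc) (subT (exts σ) P)
subT-exts²-ext-suc σ P = trans (subT-renT (exts (exts σ)) (ext suc) P)
  (trans (subT-cong exts²-ext-suc P) (sym (renT-subT (ext suc) (exts σ) P)))
  where
  exts²-ext-suc : exts (exts σ) ∘ ext suc ≗ renV (ext suc) ∘ exts σ
  exts²-ext-suc zero    = refl
  exts²-ext-suc (suc n) = renV-comm (λ _ → refl) (σ n)

subT-headSubst : ∀ σ U W P →
  subT σ (headSubst U W P) ≡ headSubst (subV σ U) (subV σ W) (subT (exts σ) P)
subT-headSubst σ (var y) W P = refl
subT-headSubst σ (lam A) W P = cong (cut (lam (subT (exts σ) A)))
  (cong₂ (app zero) (subV-exts-shiftV σ W) (subT-exts²-ext-suc σ P))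

subV-exts : ∀ τ σ → subV (exts τ) ∘ exts σ ≗ exts (subV τ ∘ σ)
subV-exts τ σ zero    = refl
subV-exts τ σ (suc n) = subV-exts-shiftV τ (σ n)

mutual
  subV-subV : ∀ τ σ V → subV τ (subV σ V) ≡ subV (subV τ ∘ σ) V
  subV-subV τ σ (var x) = refl
  subV-subV τ σ (lam M) =
    cong lam (trans (subT-subT (exts τ) (exts σ) M) (subT-cong (subV-exts τ σ) M))

  subT-subT : ∀ τ σ M → subT τ (subT σ M) ≡ subT (subV τ ∘ σ) M
  subT-subT τ σ (ret V)     = cong ret (subV-subV τ σ V)
  subT-subT τ σ (app x V N) = trans (subT-headSubst τ (σ x) (subV σ V) (subT (exts σ) N))
    (cong₂ (headSubst (subV τ (σ x))) (subV-subV τ σ V)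
      (trans (subT-subT (exts τ) (exts σ) N) (subT-cong (subV-exts τ σ) N)))
  subT-subT τ σ (cut V N)   = cong₂ cut (subV-subV τ σ V)
    (trans (subT-subT (exts τ) (exts σ) N) (subT-cong (subV-exts τ σ) N))

exts-var : ∀ {σ} → σ ≗ var → exts σ ≗ var
exts-var e zero    = refl
exts-var e (suc n) = cong shiftV (e n)

mutual
  subV-var : ∀ {σ} → σ ≗ var → ∀ V → subV σ V ≡ V
  subV-var e (var x) = e x
  subV-var e (lam M) = cong lam (subT-var (exts-var e) M)

  subT-var : ∀ {σ} → σ ≗ var → ∀ M → subT σ M ≡ M
  subT-var e (ret V)     = cong ret (subV-var e V)
  subT-var e (app x V N) = cong₃ headSubst (e x) (subV-var e V) (subT-var (exts-var e) N)
  subT-var e (cut V N)   = cong₂ cut (subV-var e V) (subT-var (exts-var e) N)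


shiftV-substVar : ∀ k V n → shiftV (substVar k V n) ≡
  (if n ≡ᵇ k then shiftV V else (if n <ᵇ k then var (suc n) else var n))
shiftV-substVar zero    V zero    = refl
shiftV-substVar (suc k) V zero    = refl
shiftV-substVar k       V (suc m) with suc m ≡ᵇ k
... | true  = refl
... | false with suc m <ᵇ k
...   | true  = refl
...   | false = refl

exts-substVar : ∀ k V → exts (substVar k V) ≗ substVar (suc k) (shiftV V)
exts-substVar k V zero    = refl
exts-substVar k V (suc n) = shiftV-substVar k V n

headSubst-substVar : ∀ k V x W P →
  (if x ≡ᵇ k then headSubst V W P else (if x <ᵇ k then app x W P else app (pred x) W P))
  ≡ headSubst (substVar k V x) W P
headSubst-substVar k V x W P with x ≡ᵇ k
... | true  = refl
... | false with x <ᵇ k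
...   | true  = refl
...   | false = refl

mutual
  substV≡subV : ∀ k V W → substV k V W ≡ subV (substVar k V) W
  substV≡subV k V (var n) = refl
  substV≡subV k V (lam M) = cong lam (trans (substT≡subT (suc k) (shiftV V) M)
    (sym (subT-cong (exts-substVar k V) M)))

  substT≡subT : ∀ k V M → substT k V M ≡ subT (substVar k V) M
  substT≡subT k V (ret W)     = cong ret (substV≡subV k V W)
  substT≡subT k V (app x W P) =
    trans (headSubst-substVar k V x (substV k V W) (substT (suc k) (shiftV V) P))
      (cong₂ (headSubst (substVar k V x)) (substV≡subV k V W)
        (trans (substT≡subT (suc k) (shiftV V) P) (sym (subT-cong (exts-substVar k V) P))))
  substT≡subT k V (cut W P)   = cong₂ cut (substV≡subV k V W)
    (trans (substT≡subT (suc k) (shiftV V) P) (sym (subT-cong (exts-substVar k V) P)))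

σ₀ : Val → Sub
σ₀ = substVar zero

[]≡subT-σ₀ : ∀ V N → N [ V ] ≡ subT (σ₀ V) N
[]≡subT-σ₀ = substT≡subT zero

subV-σ₀-shiftV : ∀ U W → subV (σ₀ U) (shiftV W) ≡ W
subV-σ₀-shiftV U W = trans (subV-renV (σ₀ U) suc W) (subV-var (λ _ → refl) W)

subT-exts-σ₀-ext-suc : ∀ U P → subT (exts (σ₀ U)) (renT (ext suc) P) ≡ P
subT-exts-σ₀-ext-suc U P =
  trans (subT-renT (exts (σ₀ U)) (ext suc) P) (subT-var (λ { zero → refl ; (suc n) → refl }) P)

σ₀-renV : ∀ ρ U → σ₀ (renV ρ U) ∘ ext ρ ≗ renV ρ ∘ σ₀ U
σ₀-renV ρ U zero    = refl
σ₀-renV ρ U (suc n) = refl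

σ₀-subV : ∀ σ U → subV (σ₀ (subV σ U)) ∘ exts σ ≗ subV σ ∘ σ₀ U
σ₀-subV σ U zero    = refl
σ₀-subV σ U (suc m) = subV-σ₀-shiftV _ (σ m)

renV-σ₀-comm : ∀ ρ U W → renV ρ (subV (σ₀ U) W) ≡ subV (σ₀ (renV ρ U)) (renV (ext ρ) W)
renV-σ₀-comm ρ U W =
  trans (renV-subV ρ _ W) (sym (trans (subV-renV _ _ W) (subV-cong (σ₀-renV ρ U) W)))

renT-σ₀-comm : ∀ ρ U N → renT ρ (subT (σ₀ U) N) ≡ subT (σ₀ (renV ρ U)) (renT (ext ρ) N)
renT-σ₀-comm ρ U N =
  trans (renT-subT ρ _ N) (sym (trans (subT-renT _ _ N) (subT-cong (σ₀-renV ρ U) N)))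

renT-exts-σ₀-comm : ∀ ρ U P → renT (ext ρ) (subT (exts (σ₀ U)) P)
  ≡ subT (exts (σ₀ (renV ρ U))) (renT (ext (ext ρ)) P)
renT-exts-σ₀-comm ρ U P =
  trans (renT-subT (ext ρ) _ P) (sym (trans (subT-renT _ _ P) (subT-cong commutes P)))
  where
  commutes : exts (σ₀ (renV ρ U)) ∘ ext (ext ρ) ≗ renV (ext ρ) ∘ exts (σ₀ U)
  commutes n = trans (exts-ext _ (ext ρ) n)
    (trans (exts-cong (σ₀-renV ρ U) n) (sym (renV-exts ρ _ n)))

subV-σ₀-comm : ∀ σ U W → subV σ (subV (σ₀ U) W) ≡ subV (σ₀ (subV σ U)) (subV (exts σ) W)
subV-σ₀-comm σ U W =
  trans (subV-subV σ _ W) (sym (trans (subV-subV _ _ W) (subV-cong (σ₀-subV σ U) W)))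

subT-σ₀-comm : ∀ σ U N → subT σ (subT (σ₀ U) N) ≡ subT (σ₀ (subV σ U)) (subT (exts σ) N)
subT-σ₀-comm σ U N =
  trans (subT-subT σ _ N) (sym (trans (subT-subT _ _ N) (subT-cong (σ₀-subV σ U) N)))

subT-exts-σ₀-comm : ∀ σ U P → subT (exts σ) (subT (exts (σ₀ U)) P)
  ≡ subT (exts (σ₀ (subV σ U))) (subT (exts (exts σ)) P)
subT-exts-σ₀-comm σ U P =
  trans (subT-subT (exts σ) _ P) (sym (trans (subT-subT _ _ P) (subT-cong commutes P)))
  where
  commutes : subV (exts (σ₀ (subV σ U))) ∘ exts (exts σ) ≗ subV (exts σ) ∘ exts (σ₀ U)
  commutes n = trans (subV-exts _ (exts σ) n)
    (trans (exts-cong (σ₀-subV σ U) n) (sym (subV-exts σ _ n)))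

renT-dcut : ∀ ρ M N → renT ρ (dcut M N) ≡ dcut (renT ρ M) (renT (ext ρ) N)
renT-dcut ρ (ret V)     N = refl
renT-dcut ρ (app x V M) N = cong (app (ρ x) (renV ρ V))
  (trans (renT-dcut (ext ρ) M (renT (ext suc) N))
    (cong (dcut (renT (ext ρ) M)) (renT-comm (ext-suc-natural ρ) N)))
renT-dcut ρ (cut V M)   N = cong (cut (renV ρ V))
  (trans (renT-dcut (ext ρ) M (renT (ext suc) N))
    (cong (dcut (renT (ext ρ) M)) (renT-comm (ext-suc-natural ρ) N)))

renT-ext-suc-dcut : ∀ M N → renT (ext suc) (dcut M (renT (ext suc) N))
  ≡ dcut (renT (ext suc) M) (renT (ext suc) (renT (ext suc) N))
renT-ext-suc-dcut M N =
  trans (renT-dcut (ext suc) M (renT (ext suc) N))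
    (cong (dcut (renT (ext suc) M)) (renT-comm (ext-suc-natural suc) N))

dcut-headSubst : ∀ U V M N →
  dcut (headSubst U V M) N ≡ headSubst U V (dcut M (renT (ext suc) N))
dcut-headSubst (var y) V M N = refl
dcut-headSubst (lam A) V M N =
  cong (cut (lam A) ∘ app zero (shiftV V)) (sym (renT-ext-suc-dcut M N))

subT-dcut : ∀ σ M N → subT σ (dcut M N) ≡ dcut (subT σ M) (subT (exts σ) N)
subT-dcut σ (ret V)     N = refl
subT-dcut σ (app x V M) N =
  trans (cong (headSubst (σ x) (subV σ V))
          (trans (subT-dcut (exts σ) M (renT (ext suc) N))
                 (cong (dcut (subT (exts σ) M)) (subT-exts²-ext-suc σ N))))
        (sym (dcut-headSubst (σ x) (subV σ V) (subT (exts σ) M) (subT (exts σ) N)))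
subT-dcut σ (cut V M)   N = cong (cut (subV σ V))
  (trans (subT-dcut (exts σ) M (renT (ext suc) N))
         (cong (dcut (subT (exts σ) M)) (subT-exts²-ext-suc σ N)))

dcut-assoc : ∀ M N P → dcut (dcut M N) P ≡ dcut M (dcut N (renT (ext suc) P))
dcut-assoc (ret V)     N P = refl
dcut-assoc (app x V M) N P = cong (app x V)
  (trans (dcut-assoc M (renT (ext suc) N) (renT (ext suc) P))
    (cong (dcut M) (sym (renT-ext-suc-dcut N P))))
dcut-assoc (cut V M)   N P = cong (cut V)
  (trans (dcut-assoc M (renT (ext suc) N) (renT (ext suc) P))
    (cong (dcut M) (sym (renT-ext-suc-dcut N P))))

-- The B-rule with the freshness condition on y replaced by substituting λx.A for y.
Bcontract : Tm → Val → Tm → Tm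
Bcontract A W P =
  cut (subV (σ₀ (lam A)) W) (dcut A (renT (ext suc) (subT (exts (σ₀ (lam A))) P)))

Bcontract-fresh : ∀ A W P →
  Bcontract A (shiftV W) (renT (ext suc) P) ≡ cut W (dcut A (renT (ext suc) P))
Bcontract-fresh A W P = cong₂ cut (subV-σ₀-shiftV (lam A) W)
  (cong (dcut A ∘ renT (ext suc)) (subT-exts-σ₀-ext-suc (lam A) P))

renT-Bcontract : ∀ ρ A W P → renT ρ (Bcontract A W P)
  ≡ Bcontract (renT (ext ρ) A) (renV (ext ρ) W) (renT (ext (ext ρ)) P)
renT-Bcontract ρ A W P = cong₂ cut (renV-σ₀-comm ρ (lam A) W) (begin
  renT (ext ρ) (dcut A (renT (ext suc) Y))
    ≡⟨ renT-dcut (ext ρ) A (renT (ext suc) Y) ⟩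
  dcut ρA (renT (ext (ext ρ)) (renT (ext suc) Y))
    ≡⟨ cong (dcut ρA) (renT-comm (ext-suc-natural ρ) Y) ⟩
  dcut ρA (renT (ext suc) (renT (ext ρ) Y))
    ≡⟨ cong (dcut ρA ∘ renT (ext suc)) (renT-exts-σ₀-comm ρ (lam A) P) ⟩
  dcut ρA (renT (ext suc) (subT (exts (σ₀ (lam ρA))) (renT (ext (ext ρ)) P)))
    ∎)
  where
  Y  = subT (exts (σ₀ (lam A))) P
  ρA = renT (ext ρ) A

subT-Bcontract : ∀ σ A W P → subT σ (Bcontract A W P)
  ≡ Bcontract (subT (exts σ) A) (subV (exts σ) W) (subT (exts (exts σ)) P)
subT-Bcontract σ A W P = cong₂ cut (subV-σ₀-comm σ (lam A) W) (begin
  subT (exts σ) (dcut A (renT (ext suc) Y))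
    ≡⟨ subT-dcut (exts σ) A (renT (ext suc) Y) ⟩
  dcut σA (subT (exts (exts σ)) (renT (ext suc) Y))
    ≡⟨ cong (dcut σA) (subT-exts²-ext-suc σ Y) ⟩
  dcut σA (renT (ext suc) (subT (exts σ) Y))
    ≡⟨ cong (dcut σA ∘ renT (ext suc)) (subT-exts-σ₀-comm σ (lam A) P) ⟩
  dcut σA (renT (ext suc) (subT (exts (σ₀ (lam σA))) (subT (exts (exts σ)) P)))
    ∎)
  where
  Y  = subT (exts (σ₀ (lam A))) P
  σA = subT (exts σ) A

dcut-Bcontract : ∀ A W P N →
  dcut (Bcontract A W P) N ≡ Bcontract A W (dcut P (renT (ext suc) (renT (ext suc) N)))
dcut-Bcontract A W P N = cong (cut (subV (σ₀ (lam A)) W)) (begin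
  dcut (dcut A (renT (ext suc) Y)) (renT (ext suc) N)
    ≡⟨ dcut-assoc A (renT (ext suc) Y) (renT (ext suc) N) ⟩
  dcut A (dcut (renT (ext suc) Y) (renT (ext suc) (renT (ext suc) N)))
    ≡⟨ cong (dcut A) (sym (renT-ext-suc-dcut Y N)) ⟩
  dcut A (renT (ext suc) (dcut Y (renT (ext suc) N)))
    ≡⟨ cong (dcut A ∘ renT (ext suc)) (sym Y-dcut) ⟩
  dcut A (renT (ext suc) (subT σ (dcut P (renT (ext suc) (renT (ext suc) N)))))
    ∎)
  where
  σ = exts (σ₀ (lam A))
  Y = subT σ P
  Y-dcut : subT σ (dcut P (renT (ext suc) (renT (ext suc) N))) ≡ dcut Y (renT (ext suc) N)
  Y-dcut = trans (subT-dcut σ P _)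
    (cong (dcut Y) (trans (subT-exts²-ext-suc (σ₀ (lam A)) (renT (ext suc) N))
                          (cong (renT (ext suc)) (subT-exts-σ₀-ext-suc (lam A) N))))

-- Parallel reduction

mutual
  data _⇒V_ : Val → Val → Set where
    pvar : ∀ {x} → var x ⇒V var x
    plam : ∀ {M M'} → M ⇒ M' → lam M ⇒V lam M'

  data _⇒_ : Tm → Tm → Set where
    pret : ∀ {V V'} → V ⇒V V' → ret V ⇒ ret V'
    papp : ∀ {x V V' N N'} → V ⇒V V' → N ⇒ N' → app x V N ⇒ app x V' N'
    pcut : ∀ {V V' N N'} → V ⇒V V' → N ⇒ N' → cut V N ⇒ cut V' N'
    pσ   : ∀ {V V' N N'} → V ⇒V V' → N ⇒ N' → cut V N ⇒ subT (σ₀ V') N'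
    pB   : ∀ {A A' W W' P P'} → A ⇒ A' → W ⇒V W' → P ⇒ P' →
           cut (lam A) (app zero W P) ⇒ Bcontract A' W' P'

infixl 4 _⟨≡_
_⟨≡_ : ∀ {M N N'} → M ⇒ N → N ≡ N' → M ⇒ N'
M⇒N ⟨≡ refl = M⇒N

mutual
  ⇒V-refl : ∀ V → V ⇒V V
  ⇒V-refl (var x) = pvar
  ⇒V-refl (lam M) = plam (⇒-refl M)

  ⇒-refl : ∀ M → M ⇒ M
  ⇒-refl (ret V)     = pret (⇒V-refl V)
  ⇒-refl (app x V N) = papp (⇒V-refl V) (⇒-refl N)
  ⇒-refl (cut V N)   = pcut (⇒V-refl V) (⇒-refl N)

mutual
  ⇒V-renV : ∀ ρ {V V'} → V ⇒V V' → renV ρ V ⇒V renV ρ V'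
  ⇒V-renV ρ pvar     = pvar
  ⇒V-renV ρ (plam m) = plam (⇒-renT (ext ρ) m)

  ⇒-renT : ∀ ρ {M M'} → M ⇒ M' → renT ρ M ⇒ renT ρ M'
  ⇒-renT ρ (pret v)   = pret (⇒V-renV ρ v)
  ⇒-renT ρ (papp v n) = papp (⇒V-renV ρ v) (⇒-renT (ext ρ) n)
  ⇒-renT ρ (pcut v n) = pcut (⇒V-renV ρ v) (⇒-renT (ext ρ) n)
  ⇒-renT ρ (pσ {V' = U'} {N' = N'} v n) =
    pσ (⇒V-renV ρ v) (⇒-renT (ext ρ) n) ⟨≡ sym (renT-σ₀-comm ρ U' N')
  ⇒-renT ρ (pB {A' = A'} {W' = W'} {P' = P'} a w p) =
    pB (⇒-renT (ext ρ) a) (⇒V-renV (ext ρ) w) (⇒-renT (ext (ext ρ)) p)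
    ⟨≡ sym (renT-Bcontract ρ A' W' P')

_⇒S_ : Sub → Sub → Set
σ ⇒S σ' = ∀ n → σ n ⇒V σ' n

⇒S-exts : ∀ {σ σ'} → σ ⇒S σ' → exts σ ⇒S exts σ'
⇒S-exts s zero    = pvar
⇒S-exts s (suc n) = ⇒V-renV suc (s n)

⇒S-σ₀ : ∀ {V V'} → V ⇒V V' → σ₀ V ⇒S σ₀ V'
⇒S-σ₀ v zero    = v
⇒S-σ₀ v (suc n) = pvar

⇒-headSubst : ∀ {U U' W W' P P'} → U ⇒V U' → W ⇒V W' → P ⇒ P' →
  headSubst U W P ⇒ headSubst U' W' P'
⇒-headSubst pvar     w p = papp w p
⇒-headSubst (plam a) w p = pcut (plam a) (papp (⇒V-renV suc w) (⇒-renT (ext suc) p))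

mutual
  ⇒V-subV : ∀ {σ σ'} → σ ⇒S σ' → ∀ {V V'} → V ⇒V V' → subV σ V ⇒V subV σ' V'
  ⇒V-subV s (pvar {x}) = s x
  ⇒V-subV s (plam m)   = plam (⇒-subT (⇒S-exts s) m)

  ⇒-subT : ∀ {σ σ'} → σ ⇒S σ' → ∀ {M M'} → M ⇒ M' → subT σ M ⇒ subT σ' M'
  ⇒-subT s (pret v)           = pret (⇒V-subV s v)
  ⇒-subT s (papp {x = x} v n) = ⇒-headSubst (s x) (⇒V-subV s v) (⇒-subT (⇒S-exts s) n)
  ⇒-subT s (pcut v n)         = pcut (⇒V-subV s v) (⇒-subT (⇒S-exts s) n)
  ⇒-subT {σ' = σ'} s (pσ {V' = U'} {N' = N'} v n) =
    pσ (⇒V-subV s v) (⇒-subT (⇒S-exts s) n) ⟨≡ sym (subT-σ₀-comm σ' U' N')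
  ⇒-subT {σ' = σ'} s (pB {A' = A'} {W' = W'} {P' = P'} a w p) =
    pB (⇒-subT (⇒S-exts s) a) (⇒V-subV (⇒S-exts s) w) (⇒-subT (⇒S-exts (⇒S-exts s)) p)
    ⟨≡ sym (subT-Bcontract σ' A' W' P')

⇒-σ₀ : ∀ {V V' N N'} → V ⇒V V' → N ⇒ N' → subT (σ₀ V) N ⇒ subT (σ₀ V') N'
⇒-σ₀ v = ⇒-subT (⇒S-σ₀ v)

⇒-dcut : ∀ {M M' N N'} → M ⇒ M' → N ⇒ N' → dcut M N ⇒ dcut M' N'
⇒-dcut (pret v)   n = pcut v n
⇒-dcut (papp v m) n = papp v (⇒-dcut m (⇒-renT (ext suc) n))
⇒-dcut (pcut v m) n = pcut v (⇒-dcut m (⇒-renT (ext suc) n))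
⇒-dcut {N' = N'} (pσ {V' = U'} {N' = Q'} v m) n =
  pσ v (⇒-dcut m (⇒-renT (ext suc) n))
  ⟨≡ trans (subT-dcut (σ₀ U') Q' (renT (ext suc) N'))
           (cong (dcut (subT (σ₀ U') Q')) (subT-exts-σ₀-ext-suc U' N'))
⇒-dcut {N' = N'} (pB {A' = A'} {W' = W'} {P' = P'} a w p) n =
  pB a w (⇒-dcut p (⇒-renT (ext suc) (⇒-renT (ext suc) n)))
  ⟨≡ sym (dcut-Bcontract A' W' P' N')

⇒-Bcontract : ∀ {A A' W W' P P'} → A ⇒ A' → W ⇒V W' → P ⇒ P' →
  Bcontract A W P ⇒ Bcontract A' W' P'
⇒-Bcontract a w p =
  pcut (⇒V-subV λA⇒λA' w) (⇒-dcut a (⇒-renT (ext suc) (⇒-subT (⇒S-exts λA⇒λA') p)))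
  where λA⇒λA' = ⇒S-σ₀ (plam a)


mutual
  devV : Val → Val
  devV (var x) = var x
  devV (lam M) = lam (dev M)

  dev : Tm → Tm
  dev (ret V)                      = ret (devV V)
  dev (app x V N)                  = app x (devV V) (dev N)
  dev (cut (lam A) (app zero W P)) = Bcontract (dev A) (devV W) (dev P)
  dev (cut V N)                    = subT (σ₀ (devV V)) (dev N)

mutual
  ⇒V-triangle : ∀ {V W} → V ⇒V W → W ⇒V devV V
  ⇒V-triangle pvar     = pvar
  ⇒V-triangle (plam m) = plam (⇒-triangle m)

  ⇒-triangle : ∀ {M N} → M ⇒ N → N ⇒ dev M
  ⇒-triangle (pret v)   = pret (⇒V-triangle v)
  ⇒-triangle (papp v n) = papp (⇒V-triangle v) (⇒-triangle n)
  ⇒-triangle (pcut pvar n)                            = pσ pvar (⇒-triangle n)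
  ⇒-triangle (pcut (plam a) (papp {x = zero} w p)) =
    pB (⇒-triangle a) (⇒V-triangle w) (⇒-triangle p)
  ⇒-triangle (pcut (plam a) n@(pret _))               = pσ (plam (⇒-triangle a)) (⇒-triangle n)
  ⇒-triangle (pcut (plam a) n@(papp {x = suc _} _ _)) = pσ (plam (⇒-triangle a)) (⇒-triangle n)
  ⇒-triangle (pcut (plam a) n@(pcut _ _))             = pσ (plam (⇒-triangle a)) (⇒-triangle n)
  ⇒-triangle (pcut (plam a) n@(pσ _ _))               = pσ (plam (⇒-triangle a)) (⇒-triangle n)
  ⇒-triangle (pcut (plam a) n@(pB _ _ _))             = pσ (plam (⇒-triangle a)) (⇒-triangle n)
  ⇒-triangle (pσ pvar n)                              = ⇒-σ₀ pvar (⇒-triangle n)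
  -- The σ-contractum of a B-redex is again a B-redex, now with y fresh.
  ⇒-triangle (pσ {V = lam A} (plam a) (papp {x = zero} w p)) =
    pB (⇒-triangle a) (⇒V-renV suc (⇒V-subV λA⇒ (⇒V-triangle w)))
       (⇒-renT (ext suc) (⇒-subT (⇒S-exts λA⇒) (⇒-triangle p)))
    ⟨≡ Bcontract-fresh (dev A) _ _
    where λA⇒ = ⇒S-σ₀ (plam (⇒-triangle a))
  ⇒-triangle (pσ (plam a) n@(pret _))                 = ⇒-σ₀ (plam (⇒-triangle a)) (⇒-triangle n)
  ⇒-triangle (pσ (plam a) n@(papp {x = suc _} _ _))   = ⇒-σ₀ (plam (⇒-triangle a)) (⇒-triangle n)
  ⇒-triangle (pσ (plam a) n@(pcut _ _))               = ⇒-σ₀ (plam (⇒-triangle a)) (⇒-triangle n)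
  ⇒-triangle (pσ (plam a) n@(pσ _ _))                 = ⇒-σ₀ (plam (⇒-triangle a)) (⇒-triangle n)
  ⇒-triangle (pσ (plam a) n@(pB _ _ _))               = ⇒-σ₀ (plam (⇒-triangle a)) (⇒-triangle n)
  ⇒-triangle (pB a w p) = ⇒-Bcontract (⇒-triangle a) (⇒V-triangle w) (⇒-triangle p)

mutual
  _≟V_ : (V W : Val) → Dec (V ≡ W)
  var x ≟V var y = map′ (cong var) (λ { refl → refl }) (x ≟ℕ y)
  lam M ≟V lam N = map′ (cong lam) (λ { refl → refl }) (M ≟T N)
  var _ ≟V lam _ = no λ ()
  lam _ ≟V var _ = no λ ()

  _≟T_ : (M N : Tm) → Dec (M ≡ N)
  ret V ≟T ret W = map′ (cong ret) (λ { refl → refl }) (V ≟V W)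
  app x V N ≟T app y W P = map′ (λ { (refl , refl , refl) → refl }) (λ { refl → refl , refl , refl })
    (x ≟ℕ y ×-dec V ≟V W ×-dec N ≟T P)
  cut V N ≟T cut W P = map′ (λ { (refl , refl) → refl }) (λ { refl → refl , refl })
    (V ≟V W ×-dec N ≟T P)
  ret _ ≟T app _ _ _ = no λ ()
  ret _ ≟T cut _ _   = no λ ()
  app _ _ _ ≟T ret _ = no λ ()
  app _ _ _ ≟T cut _ _ = no λ ()
  cut _ _ ≟T ret _   = no λ ()
  cut _ _ ≟T app _ _ _ = no λ ()

BRedex-unshifted : ∀ {A W P} → BRedex (cut (lam A) (app zero W P)) →
  W ≡ shiftV (renV pred W) × P ≡ renT (ext suc) (renT (ext pred) P)
BRedex-unshifted (bredex _ W P) =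
  cong shiftV (sym (renV-pred-shiftV W)) , cong (renT (ext suc)) (sym (renT-ext-pred-ext-suc P))

unshifted-BRedex : ∀ {A W P} →
  W ≡ shiftV (renV pred W) × P ≡ renT (ext suc) (renT (ext pred) P) →
  BRedex (cut (lam A) (app zero W P))
unshifted-BRedex {A} {W} {P} (W≡ , P≡) =
  subst₂ (λ W P → BRedex (cut (lam A) (app zero W P))) (sym W≡) (sym P≡)
    (bredex A (renV pred W) (renT (ext pred) P))

BRedex? : ∀ V N → Dec (BRedex (cut V N))
BRedex? (var x) N                  = no λ ()
BRedex? (lam A) (ret W)            = no λ ()
BRedex? (lam A) (app (suc k) W P)  = no λ ()
BRedex? (lam A) (cut W P)          = no λ ()
BRedex? (lam A) (app zero W P)     = map′ unshifted-BRedex BRedex-unshifted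
  (W ≟V shiftV (renV pred W) ×-dec P ≟T renT (ext suc) (renT (ext pred) P))

subT-σ₀-BRedex : ∀ {V N} → BRedex (cut V N) → subT (σ₀ V) N ≡ cut V N
subT-σ₀-BRedex (bredex A W P) =
  cong₂ (λ W' P' → cut (lam A) (app zero (shiftV W') (renT (ext suc) P')))
    (subV-σ₀-shiftV (lam A) W) (subT-exts-σ₀-ext-suc (lam A) P)

cut⟶*subT-σ₀ : ∀ V N → cut V N ⟶* subT (σ₀ V) N
cut⟶*subT-σ₀ V N with BRedex? V N
... | yes b  = subst (cut V N ⟶*_) (sym (subT-σ₀-BRedex b)) ε
... | no ¬b = subst (cut V N ⟶*_) ([]≡subT-σ₀ V N) (root (σv V N ¬b) ◅ ε)


mutual
  ⟶V⊆⇒V : ∀ {V W} → V ⟶V W → V ⇒V W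
  ⟶V⊆⇒V (ξlam m) = plam (⟶⊆⇒ m)

  ⟶⊆⇒ : ∀ {M N} → M ⟶ N → M ⇒ N
  ⟶⊆⇒ (root (Bv M V N)) =
    pB (⇒-refl M) (⇒V-refl (shiftV V)) (⇒-refl (renT (ext suc) N)) ⟨≡ Bcontract-fresh M V N
  ⟶⊆⇒ (root (σv V N _)) = pσ (⇒V-refl V) (⇒-refl N) ⟨≡ sym ([]≡subT-σ₀ V N)
  ⟶⊆⇒ (ξret v)  = pret (⟶V⊆⇒V v)
  ⟶⊆⇒ (ξappV v) = papp (⟶V⊆⇒V v) (⇒-refl _)
  ⟶⊆⇒ (ξappN n) = papp (⇒V-refl _) (⟶⊆⇒ n)
  ⟶⊆⇒ (ξcutV v) = pcut (⟶V⊆⇒V v) (⇒-refl _)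
  ⟶⊆⇒ (ξcutN n) = pcut (⇒V-refl _) (⟶⊆⇒ n)

app-⟶* : ∀ {x V V' N N'} → Star _⟶V_ V V' → N ⟶* N' → app x V N ⟶* app x V' N'
app-⟶* {x} {V' = V'} {N = N} v n = gmap (λ V → app x V N) ξappV v ◅◅ gmap (app x V') ξappN n

cut-⟶* : ∀ {V V' N N'} → Star _⟶V_ V V' → N ⟶* N' → cut V N ⟶* cut V' N'
cut-⟶* {V' = V'} {N = N} v n = gmap (λ V → cut V N) ξcutV v ◅◅ gmap (cut V') ξcutN n

mutual
  ⇒V⊆⟶V* : ∀ {V W} → V ⇒V W → Star _⟶V_ V W
  ⇒V⊆⟶V* pvar     = ε
  ⇒V⊆⟶V* (plam m) = gmap lam ξlam (⇒⊆⟶* m)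

  ⇒⊆⟶* : ∀ {M N} → M ⇒ N → M ⟶* N
  ⇒⊆⟶* (pret v)   = gmap ret ξret (⇒V⊆⟶V* v)
  ⇒⊆⟶* (papp v n) = app-⟶* (⇒V⊆⟶V* v) (⇒⊆⟶* n)
  ⇒⊆⟶* (pcut v n) = cut-⟶* (⇒V⊆⟶V* v) (⇒⊆⟶* n)
  ⇒⊆⟶* (pσ {V' = V'} {N' = N'} v n) = cut-⟶* (⇒V⊆⟶V* v) (⇒⊆⟶* n) ◅◅ cut⟶*subT-σ₀ V' N'
  ⇒⊆⟶* (pB {A' = A'} {W' = W'} {P' = P'} a w p) =
    cut-⟶* (gmap lam ξlam (⇒⊆⟶* a)) (app-⟶* (⇒V⊆⟶V* w) (⇒⊆⟶* p))
    ◅◅ cut⟶*subT-σ₀ (lam A') (app zero W' P')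
    ◅◅ root (Bv A' (subV (σ₀ (lam A')) W') (subT (exts (σ₀ (lam A'))) P')) ◅ ε

corollary6 : ∀ {M N₁ N₂} → M ⟶* N₁ → M ⟶* N₂ → Σ Tm (λ P → (N₁ ⟶* P) × (N₂ ⟶* P))
corollary6 = confluent-between ⟶⊆⇒ ⇒⊆⟶* (triangle⇒confluent dev ⇒-triangle)
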